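{- For all bouquets $\Psi,\Phi$: $\Psi\vdash_{\mathsf N}\Phi$ if and only if $\vdash_{\mathsf N}(\Psi\rhd\Phi)$.
   Context: Fix a countable set $\mathcal{V}$ of variables and a first-order signature consisting of a countable set $\mathcal{P}$ of predicate symbols with an arity function $\mathrm{ar}:\mathcal{P}\to\mathbb{N}$. Flowers and gardens are defined by mutual induction: (1) if $p\in\mathcal{P}$ and $\vec{x}\in\mathcal{V}^{\mathrm{ar}(p)}$, then the atom $p(\vec{x})$ is a flower; (2) if $\mathbf{x}\subset\mathcal{V}$ is a finite set (a sprinkler; its elements are binders) and $\Phi$ is a finite multiset of flowers (a bouquet), then $\mathbf{x}\cdot\Phi$ is a garden; (3) if $\gamma$ is a garden (the pistil) and $\Delta$ is a finite multiset of gardens (a corolla, whose elements are petals), then $\gamma\rhd\Delta$ is a flower, also written $\gamma\rhd\delta_1;\dots;\delta_n$. A garden $\emptyset\cdot\Phi$ is written simply $\Phi$; the empty bouquet is $\emptyset$; a comma denotes multiset union of bouquets; $\mathbf{x},\mathbf{y}$ denotes $\mathbf{x}\cup\mathbf{y}$. For bouquets $\Psi,\Phi$, $(\Psi\rhd\Phi)$ denotes the flower with pistil $\emptyset\cdot\Psi$ and single petal $\emptyset\cdot\Phi$. Free variables: $\mathrm{fv}(p(\vec x))$ = variables of $\vec x$; $\mathrm{fv}(\Phi)=\bigcup_{\phi\in\Phi}\mathrm{fv}(\phi)$; $\mathrm{fv}(\mathbf{x}\cdot\Phi)=\mathrm{fv}(\Phi)\setminus\mathbf{x}$; $\mathrm{fv}(\mathbf{x}\cdot\Phi\rhd\Delta)=\mathrm{fv}(\mathbf{x}\cdot\Phi)\cup\bigcup_{\mathbf{y}\cdot\Psi\in\Delta}\mathrm{fv}((\mathbf{x}\cup\mathbf{y})\cdot\Psi)$.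 Bound variables: $\mathrm{bv}(p(\vec x))=\emptyset$; $\mathrm{bv}(\Phi)=\bigcup\mathrm{bv}(\phi)$; $\mathrm{bv}(\mathbf{x}\cdot\Phi)=\mathbf{x}\cup\mathrm{bv}(\Phi)$; $\mathrm{bv}(\gamma\rhd\Delta)=\mathrm{bv}(\gamma)\cup\bigcup_{\delta\in\Delta}\mathrm{bv}(\delta)$. Standing convention: every bouquet considered has pairwise distinct binders and $\mathrm{bv}(\Phi)\cap\mathrm{fv}(\Phi)=\emptyset$. Substitutions: $f[R\mapsto g]$ equals $g$ on $R$ and $f$ elsewhere. A substitution is $\sigma:\mathcal V\to\mathcal V$ with finite support; $\sigma:\mathbf y$ means support $\mathbf y$; $\sigma_{ -\mathbf x}:=\sigma[\mathbf x\mapsto\mathrm{id}]$. Action: $\sigma(p(x_1,\dots,x_n))=p(\sigma(x_1),\dots,\sigma(x_n))$, elementwise on bouquets, $\sigma(\mathbf x\cdot\Phi)=\mathbf x\cdot\sigma_{ -\mathbf x}(\Phi)$, $\sigma(\mathbf x\cdot\Phi\rhd\delta_1;\dots;\delta_n)=\sigma(\mathbf x\cdot\Phi)\rhd\sigma_{ -\mathbf x}(\delta_1);\dots;\sigma_{ -\mathbf x}(\delta_n)$. $\sigma:\mathbf y$ is capture-avoiding in $\Phi$ if $\sigma(\mathbf y)\cap\mathrm{bv}(\Phi)=\emptyset$. Contexts: $\Xi::=\Psi,\xi$, $\xi::=\Box\mid(\mathbf x\cdot\Xi\rhd\Delta)\mid(\gamma\rhd\mathbf x\cdot\Xi;\Delta)$.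 $\Xi\{\Psi\}$ replaces the hole by bouquet $\Psi$, $\Xi\{\}$ by $\emptyset$, $\Xi\{\Xi'\}$ by a context. A flower $\phi$ can be pollinated in $\Xi$ if there are a bouquet $\Psi\ni\phi$ and contexts $\Xi',\Xi_0$ with either $\Xi=\Xi'\{\Psi,\Xi_0\}$ or $\Xi=\Xi'\{\mathbf x\cdot\Psi\rhd\mathbf y\cdot\Xi_0;\Delta\}$ for some $\mathbf x,\mathbf y,\Delta$; a bouquet can be pollinated in $\Xi$ if each of its flowers can. Natural rules $\mathsf N$ (steps conclusion $\to$ premiss): (poll↓) $\Xi\{\Phi\}\to\Xi\{\}$ and (poll↑) $\Xi\{\}\to\Xi\{\Phi\}$ whenever $\Phi$ can be pollinated in $\Xi$; (epis) $\Phi\to(\emptyset\cdot\emptyset\rhd\emptyset\cdot\Phi)$; (epet) $(\gamma\rhd\emptyset\cdot\emptyset;\Delta)\to\emptyset$; (srep) $(\mathbf x\cdot(\Phi,(\emptyset\cdot\emptyset\rhd\gamma_1;\dots;\gamma_n))\rhd\Delta)\to(\mathbf x\cdot\Phi\rhd\emptyset\cdot\{(\gamma_1\rhd\Delta),\dots,(\gamma_n\rhd\Delta)\})$; (ipis) $(\mathbf x,\mathbf y\cdot\Phi\rhd\Delta)\to(\mathbf x\cdot\sigma(\Phi)\rhd\sigma(\Delta)),(\mathbf x,\mathbf y\cdot\Phi\rhd\Delta)$ with $\sigma:\mathbf y$ capture-avoiding in $(\emptyset\cdot\Phi\rhd\Delta)$; (ipet) $(\gamma\rhd\mathbf x,\mathbf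 y\cdot\Phi;\Delta)\to(\gamma\rhd\mathbf x\cdot\sigma(\Phi);\mathbf x,\mathbf y\cdot\Phi;\Delta)$ with $\sigma:\mathbf y$ capture-avoiding in $\Phi$. Natural steps are closed under arbitrary contexts: if $\Phi\to\Psi$ is an instance of an $\mathsf N$-rule then $\Xi\{\Phi\}\to_{\mathsf N}\Xi\{\Psi\}$ for every context $\Xi$. $\Phi\to^*_{\mathsf N}\Psi$ means a finite (possibly empty) sequence of natural steps. Hypothetical provability: $\Psi\vdash_{\mathsf N}\Phi$ means $\Xi\{\Phi\}\to^*_{\mathsf N}\Xi\{\}$ for every context $\Xi$ in which $\Psi$ can be pollinated; $\vdash_{\mathsf N}\Phi$ means $\emptyset\vdash_{\mathsf N}\Phi$. -}

module Defs where

open import Data.Nat using (ℕ; _≟_)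
open import Data.List using (List; []; _∷_; _++_; [_]; map; filter)
open import Data.List.Membership.Propositional using (_∈_; _∉_)
open import Data.List.Membership.DecPropositional _≟_ using (_∈?_)
open import Data.List.Relation.Binary.Subset.Propositional using (_⊆_)
open import Data.List.Relation.Binary.Permutation.Propositional using (_↭_)
open import Data.List.Relation.Binary.Pointwise using (Pointwise)
open import Data.List.Relation.Unary.All using (All)
open import Data.List.Relation.Unary.Unique.Propositional using (Unique)
open import Data.Vec using (Vec; toList)
import Data.Vec as Vec
open import Data.Product using (Σ; ∃; ∃-syntax; _×_; _,_)
open import Data.Sum using (_⊎_)
open import Relation.Nullary using (¬_; yes; no; ¬?)
open import Relation.Binary.PropositionalEquality using (_≡_)
open import Relation.Binary.Construct.Closure.ReflexiveTransitive using (Star)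

Var : Set
Var = ℕ

module Syntax {P : Set} (ar : P → ℕ) where

  -- Finite sets are represented by lists (sprinklers: lists of variables,
  -- considered up to having the same elements); finite multisets by lists
  -- considered up to permutation.
  data Flower : Set
  data Garden : Set

  data Flower where
    atom : (p : P) → Vec Var (ar p) → Flower
    _▷_  : Garden → List Garden → Flower

  data Garden where
    _·_ : List Var → List Flower → Garden

  Bouquet : Set
  Bouquet = List Flower

  Corolla : Set
  Corolla = List Garden

  -- (Ψ ⇒ Φ) is the flower  (∅·Ψ ▷ ∅·Φ),  written (Ψ ▷ Φ) in the paper.
  _⇒_ : Bouquet → Bouquet → Flower
  Ψ ⇒ Φ = ([] · Ψ) ▷ [ [] · Φ ]

  notIn : List Var → List Var → List Var
  notIn x = filter (λ v → ¬? (v ∈? x))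

  fvF : Flower → List Var
  fvB : Bouquet → List Var
  fvG : Garden → List Var
  fvPetals : List Var → Corolla → List Var

  fvF (atom p xs) = toList xs
  fvF ((x · Φ) ▷ Δ) = fvG (x · Φ) ++ fvPetals x Δ
  fvB [] = []
  fvB (φ ∷ Φ) = fvF φ ++ fvB Φ
  fvG (x · Φ) = notIn x (fvB Φ)
  fvPetals x [] = []
  fvPetals x ((y · Ψ) ∷ Δ) = notIn (x ++ y) (fvB Ψ) ++ fvPetals x Δ

  bvF : Flower → List Var
  bvB : Bouquet → List Var
  bvG : Garden → List Var
  bvC : Corolla → List Var

  bvF (atom p xs) = []
  bvF (γ ▷ Δ) = bvG γ ++ bvC Δ
  bvB [] = []
  bvB (φ ∷ Φ) = bvF φ ++ bvB Φ
  bvG (x · Φ) = x ++ bvB Φ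
  bvC [] = []
  bvC (δ ∷ Δ) = bvG δ ++ bvC Δ

  WF : Bouquet → Set
  WF Φ = Unique (bvB Φ) × (∀ v → v ∈ bvB Φ → v ∉ fvB Φ)

  Subst : List Var → Set
  Subst y = Σ (Var → Var) λ σ → ∀ v → v ∉ y → σ v ≡ v

  _₋_ : (Var → Var) → List Var → (Var → Var)
  (σ ₋ x) v with v ∈? x
  ... | yes _ = v
  ... | no  _ = σ v

  substF : (Var → Var) → Flower → Flower
  substG : (Var → Var) → Garden → Garden
  substB : (Var → Var) → Bouquet → Bouquet
  substC : (Var → Var) → Corolla → Corolla

  substF σ (atom p xs) = atom p (Vec.map σ xs)
  substF σ ((x · Φ) ▷ Δ) = substG σ (x · Φ) ▷ substC (σ ₋ x) Δ
  substG σ (x · Φ) = x · substB (σ ₋ x) Φ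
  substB σ [] = []
  substB σ (φ ∷ Φ) = substF σ φ ∷ substB σ Φ
  substC σ [] = []
  substC σ (δ ∷ Δ) = substG σ δ ∷ substC σ Δ

  CaptureAvoiding : ∀ {y} → Subst y → List Var → Set
  CaptureAvoiding {y} (σ , _) bv = ∀ v → v ∈ y → σ v ∉ bv

  data Ctx : Set
  data Hole : Set

  data Ctx where
    _,,_ : Bouquet → Hole → Ctx

  data Hole where
    □   : Hole
    pis : List Var → Ctx → Corolla → Hole
    pet : Garden → List Var → Ctx → Corolla → Hole

  _⟪_⟫ : Ctx → Bouquet → Bouquet
  _⟪_⟫ₕ : Hole → Bouquet → Bouquet
  (Ψ ,, ξ) ⟪ Φ ⟫ = Ψ ++ (ξ ⟪ Φ ⟫ₕ)
  □ ⟪ Φ ⟫ₕ = Φ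
  pis x Ξ Δ ⟪ Φ ⟫ₕ = [ (x · (Ξ ⟪ Φ ⟫)) ▷ Δ ]
  pet γ x Ξ Δ ⟪ Φ ⟫ₕ = [ γ ▷ ((x · (Ξ ⟪ Φ ⟫)) ∷ Δ) ]

  _⊕_ : Bouquet → Ctx → Ctx
  Ψ ⊕ (Ψ₀ ,, ξ) = (Ψ ++ Ψ₀) ,, ξ

  _⟪_⟫ᶜ : Ctx → Ctx → Ctx
  _⟪_⟫ᶜₕ : Hole → Ctx → Ctx
  (Ψ ,, ξ) ⟪ Ξ' ⟫ᶜ = Ψ ⊕ (ξ ⟪ Ξ' ⟫ᶜₕ)
  □ ⟪ Ξ' ⟫ᶜₕ = Ξ'
  pis x Ξ Δ ⟪ Ξ' ⟫ᶜₕ = [] ,, pis x (Ξ ⟪ Ξ' ⟫ᶜ) Δ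
  pet γ x Ξ Δ ⟪ Ξ' ⟫ᶜₕ = [] ,, pet γ x (Ξ ⟪ Ξ' ⟫ᶜ) Δ

  _≈s_ : List Var → List Var → Set
  x ≈s y = x ⊆ y × y ⊆ x

  data _≅F_ : Flower → Flower → Set
  data _≅G_ : Garden → Garden → Set
  data _≅B_ : Bouquet → Bouquet → Set
  data _≅C_ : Corolla → Corolla → Set

  data _≅F_ where
    atom : ∀ {p xs} → atom p xs ≅F atom p xs
    flw  : ∀ {γ γ' Δ Δ'} → γ ≅G γ' → Δ ≅C Δ' → (γ ▷ Δ) ≅F (γ' ▷ Δ')

  data _≅G_ where
    gdn : ∀ {x x' Φ Φ'} → x ≈s x' → Φ ≅B Φ' → (x · Φ) ≅G (x' · Φ')

  data _≅B_ where
    bq : ∀ {Φ Φ' Ψ} → Φ ↭ Φ' → Pointwise _≅F_ Φ' Ψ → Φ ≅B Ψ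

  data _≅C_ where
    cr : ∀ {Δ Δ' Γ} → Δ ↭ Δ' → Pointwise _≅G_ Δ' Γ → Δ ≅C Γ

  data _≅X_ : Ctx → Ctx → Set
  data _≅H_ : Hole → Hole → Set

  data _≅X_ where
    ctx : ∀ {Ψ Ψ' ξ ξ'} → Ψ ≅B Ψ' → ξ ≅H ξ' → (Ψ ,, ξ) ≅X (Ψ' ,, ξ')

  data _≅H_ where
    □   : □ ≅H □
    pis : ∀ {x x' Ξ Ξ' Δ Δ'} → x ≈s x' → Ξ ≅X Ξ' → Δ ≅C Δ' →
          pis x Ξ Δ ≅H pis x' Ξ' Δ'
    pet : ∀ {γ γ' x x' Ξ Ξ' Δ Δ'} → γ ≅G γ' → x ≈s x' → Ξ ≅X Ξ' → Δ ≅C Δ' →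
          pet γ x Ξ Δ ≅H pet γ' x' Ξ' Δ'

  Pollinable : Flower → Ctx → Set
  Pollinable φ Ξ =
    ∃[ Ψ ] ∃[ Ξ' ] ∃[ Ξ₀ ] (φ ∈ Ψ ×
      (  Ξ ≅X (Ξ' ⟪ Ψ ⊕ Ξ₀ ⟫ᶜ)
       ⊎ (∃[ x ] ∃[ y ] ∃[ Δ ] (Ξ ≅X (Ξ' ⟪ [] ,, pet (x · Ψ) y Ξ₀ Δ ⟫ᶜ)))))

  PollinableB : Bouquet → Ctx → Set
  PollinableB Φ Ξ = All (λ φ → Pollinable φ Ξ) Φ

  -- Natural rules (conclusion → premiss)

  data Rule : Bouquet → Bouquet → Set where
    epis : ∀ Φ → Rule Φ [ ([] · []) ▷ [ [] · Φ ] ]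
    epet : ∀ γ Δ → Rule [ γ ▷ (([] · []) ∷ Δ) ] []
    srep : ∀ x Φ γs Δ →
           Rule [ (x · (Φ ++ [ ([] · []) ▷ γs ])) ▷ Δ ]
                [ (x · Φ) ▷ [ [] · map (λ γ → γ ▷ Δ) γs ] ]
    ipis : ∀ x y Φ Δ (σ : Subst y) →
           CaptureAvoiding σ (bvF (([] · Φ) ▷ Δ)) →
           Rule [ ((x ++ y) · Φ) ▷ Δ ]
                ( ((x · substB (Σ.proj₁ σ) Φ) ▷ substC (Σ.proj₁ σ) Δ)
                ∷ [ ((x ++ y) · Φ) ▷ Δ ] )
    ipet : ∀ γ x y Φ Δ (σ : Subst y) →
           CaptureAvoiding σ (bvB Φ) →
           Rule [ γ ▷ (((x ++ y) · Φ) ∷ Δ) ]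
                [ γ ▷ ((x · substB (Σ.proj₁ σ) Φ) ∷ ((x ++ y) · Φ) ∷ Δ) ]

  data _→N_ : Bouquet → Bouquet → Set where
    poll↓ : ∀ Ξ Φ → PollinableB Φ Ξ → (Ξ ⟪ Φ ⟫) →N (Ξ ⟪ [] ⟫)
    poll↑ : ∀ Ξ Φ → PollinableB Φ Ξ → (Ξ ⟪ [] ⟫) →N (Ξ ⟪ Φ ⟫)
    rule  : ∀ Ξ {Φ Ψ} → Rule Φ Ψ → (Ξ ⟪ Φ ⟫) →N (Ξ ⟪ Ψ ⟫)

  _⇝_ : Bouquet → Bouquet → Set
  Φ ⇝ Ψ = Φ ≅B Ψ ⊎ Φ →N Ψ

  _→N*_ : Bouquet → Bouquet → Set
  _→N*_ = Star _⇝_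

  _⊢N_ : Bouquet → Bouquet → Set
  Ψ ⊢N Φ = ∀ Ξ → PollinableB Ψ Ξ → (Ξ ⟪ Φ ⟫) →N* (Ξ ⟪ [] ⟫)

  ⊢N_ : Bouquet → Set
  ⊢N Φ = [] ⊢N Φ

{-# OPTIONS --safe #-}
module Submission where

-- For ⊢ (Ψ ⇒ Φ): inside the petal of (Ψ ⇒ Φ) the pistil Ψ can be pollinated,
-- so the hypothetical derivation empties the petal, and epet erases the flower.
-- Conversely, given Ψ pollinable in Ξ, grow Ξ{Φ} into Ξ{(∅ ▷ Φ)} by epis,
-- pollinate Ψ into the empty pistil (Ψ stays pollinable in the deeper context)
-- and finish with the proof of (Ψ ⇒ Φ).

open import Defs
open import Data.Nat using (ℕ)
open import Data.List using ([]; _∷_; _++_; [_])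
open import Data.List.Properties using (++-assoc)
open import Data.List.Relation.Unary.All as All using ([])
open import Data.List.Relation.Binary.Pointwise as Pointwise using (Pointwise; []; _∷_)
open import Data.List.Relation.Binary.Permutation.Propositional using (↭-refl)
open import Data.List.Relation.Binary.Permutation.Propositional.Properties using (++⁺)
open import Data.List.Relation.Binary.Subset.Propositional.Properties using (⊆-refl)
open import Data.Product using (_,_)
open import Data.Sum using (inj₁; inj₂)
open import Function.Bundles using (_⇔_; _↣_; mk⇔)
open import Relation.Binary.PropositionalEquality using (_≡_; refl; cong; subst; subst₂; trans)
open import Relation.Binary.Construct.Closure.ReflexiveTransitive using (return; _◅◅_)

module _ {P : Set} (ar : P → ℕ) where
  open Syntax ar

  ≈s-refl : ∀ x → x ≈s x
  ≈s-refl x = ⊆-refl , ⊆-refl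

  ≅F-refl : ∀ φ → φ ≅F φ
  ≅G-refl : ∀ γ → γ ≅G γ
  ≅B-refl : ∀ Φ → Φ ≅B Φ
  ≅C-refl : ∀ Δ → Δ ≅C Δ
  ≅F-pointwise-refl : ∀ Φ → Pointwise _≅F_ Φ Φ
  ≅G-pointwise-refl : ∀ Δ → Pointwise _≅G_ Δ Δ

  ≅F-refl (atom p xs) = atom
  ≅F-refl (γ ▷ Δ) = flw (≅G-refl γ) (≅C-refl Δ)
  ≅G-refl (x · Φ) = gdn (≈s-refl x) (≅B-refl Φ)
  ≅B-refl Φ = bq ↭-refl (≅F-pointwise-refl Φ)
  ≅C-refl Δ = cr ↭-refl (≅G-pointwise-refl Δ)
  ≅F-pointwise-refl [] = []
  ≅F-pointwise-refl (φ ∷ Φ) = ≅F-refl φ ∷ ≅F-pointwise-refl Φ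
  ≅G-pointwise-refl [] = []
  ≅G-pointwise-refl (δ ∷ Δ) = ≅G-refl δ ∷ ≅G-pointwise-refl Δ

  ≅X-refl : ∀ Ξ → Ξ ≅X Ξ
  ≅H-refl : ∀ ξ → ξ ≅H ξ
  ≅X-refl (Ψ ,, ξ) = ctx (≅B-refl Ψ) (≅H-refl ξ)
  ≅H-refl □ = □
  ≅H-refl (pis x Ξ Δ) = pis (≈s-refl x) (≅X-refl Ξ) (≅C-refl Δ)
  ≅H-refl (pet γ x Ξ Δ) = pet (≅G-refl γ) (≈s-refl x) (≅X-refl Ξ) (≅C-refl Δ)

  ≅B-++ : ∀ {Φ Φ' Ψ Ψ'} → Φ ≅B Φ' → Ψ ≅B Ψ' → (Φ ++ Ψ) ≅B (Φ' ++ Ψ')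
  ≅B-++ (bq p q) (bq p' q') = bq (++⁺ p p') (Pointwise.++⁺ q q')

  ≅X-⊕ : ∀ {Ψ Ψ' Ξ Ξ'} → Ψ ≅B Ψ' → Ξ ≅X Ξ' → (Ψ ⊕ Ξ) ≅X (Ψ' ⊕ Ξ')
  ≅X-⊕ Ψ≅Ψ' (ctx Ψ₀≅Ψ₀' ξ≅ξ') = ctx (≅B-++ Ψ≅Ψ' Ψ₀≅Ψ₀') ξ≅ξ'

  ≅X-⟪⟫ᶜ : ∀ {Ξ Ξ'} Ξ₀ → Ξ ≅X Ξ' → (Ξ ⟪ Ξ₀ ⟫ᶜ) ≅X (Ξ' ⟪ Ξ₀ ⟫ᶜ)
  ≅H-⟪⟫ᶜ : ∀ {ξ ξ'} Ξ₀ → ξ ≅H ξ' → (ξ ⟪ Ξ₀ ⟫ᶜₕ) ≅X (ξ' ⟪ Ξ₀ ⟫ᶜₕ)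
  ≅X-⟪⟫ᶜ Ξ₀ (ctx Ψ≅Ψ' ξ≅ξ') = ≅X-⊕ Ψ≅Ψ' (≅H-⟪⟫ᶜ Ξ₀ ξ≅ξ')
  ≅H-⟪⟫ᶜ Ξ₀ □ = ≅X-refl Ξ₀
  ≅H-⟪⟫ᶜ Ξ₀ (pis x≈x' Ξ≅Ξ' Δ≅Δ') = ctx (≅B-refl []) (pis x≈x' (≅X-⟪⟫ᶜ Ξ₀ Ξ≅Ξ') Δ≅Δ')
  ≅H-⟪⟫ᶜ Ξ₀ (pet γ≅γ' x≈x' Ξ≅Ξ' Δ≅Δ') =
    ctx (≅B-refl []) (pet γ≅γ' x≈x' (≅X-⟪⟫ᶜ Ξ₀ Ξ≅Ξ') Δ≅Δ')

  ⊕-⟪⟫ : ∀ Ψ Ξ Φ → (Ψ ⊕ Ξ) ⟪ Φ ⟫ ≡ Ψ ++ Ξ ⟪ Φ ⟫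
  ⊕-⟪⟫ Ψ (Ψ₀ ,, ξ) Φ = ++-assoc Ψ Ψ₀ (ξ ⟪ Φ ⟫ₕ)

  ⟪⟫ᶜ-⟪⟫ : ∀ Ξ Ξ₀ Φ → (Ξ ⟪ Ξ₀ ⟫ᶜ) ⟪ Φ ⟫ ≡ Ξ ⟪ Ξ₀ ⟪ Φ ⟫ ⟫
  ⟪⟫ᶜₕ-⟪⟫ : ∀ ξ Ξ₀ Φ → (ξ ⟪ Ξ₀ ⟫ᶜₕ) ⟪ Φ ⟫ ≡ ξ ⟪ Ξ₀ ⟪ Φ ⟫ ⟫ₕ
  ⟪⟫ᶜ-⟪⟫ (Ψ ,, ξ) Ξ₀ Φ = trans (⊕-⟪⟫ Ψ (ξ ⟪ Ξ₀ ⟫ᶜₕ) Φ) (cong (Ψ ++_) (⟪⟫ᶜₕ-⟪⟫ ξ Ξ₀ Φ))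
  ⟪⟫ᶜₕ-⟪⟫ □ Ξ₀ Φ = refl
  ⟪⟫ᶜₕ-⟪⟫ (pis x Ξ Δ) Ξ₀ Φ = cong (λ Ψ → [ (x · Ψ) ▷ Δ ]) (⟪⟫ᶜ-⟪⟫ Ξ Ξ₀ Φ)
  ⟪⟫ᶜₕ-⟪⟫ (pet γ x Ξ Δ) Ξ₀ Φ = cong (λ Ψ → [ γ ▷ ((x · Ψ) ∷ Δ) ]) (⟪⟫ᶜ-⟪⟫ Ξ Ξ₀ Φ)

  ⊕-⟪⟫ᶜ : ∀ Ψ Ξ Ξ₀ → (Ψ ⊕ Ξ) ⟪ Ξ₀ ⟫ᶜ ≡ Ψ ⊕ (Ξ ⟪ Ξ₀ ⟫ᶜ)
  ⊕-⟪⟫ᶜ Ψ (Ψ₁ ,, ξ) Ξ₀ with ξ ⟪ Ξ₀ ⟫ᶜₕ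
  ... | Ψ₂ ,, ξ₂ = cong (_,, ξ₂) (++-assoc Ψ Ψ₁ Ψ₂)

  ⟪⟫ᶜ-assoc : ∀ Ξ Ξ₁ Ξ₂ → (Ξ ⟪ Ξ₁ ⟫ᶜ) ⟪ Ξ₂ ⟫ᶜ ≡ Ξ ⟪ Ξ₁ ⟪ Ξ₂ ⟫ᶜ ⟫ᶜ
  ⟪⟫ᶜₕ-assoc : ∀ ξ Ξ₁ Ξ₂ → (ξ ⟪ Ξ₁ ⟫ᶜₕ) ⟪ Ξ₂ ⟫ᶜ ≡ ξ ⟪ Ξ₁ ⟪ Ξ₂ ⟫ᶜ ⟫ᶜₕ
  ⟪⟫ᶜ-assoc (Ψ ,, ξ) Ξ₁ Ξ₂ =
    trans (⊕-⟪⟫ᶜ Ψ (ξ ⟪ Ξ₁ ⟫ᶜₕ) Ξ₂) (cong (Ψ ⊕_) (⟪⟫ᶜₕ-assoc ξ Ξ₁ Ξ₂))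
  ⟪⟫ᶜₕ-assoc □ Ξ₁ Ξ₂ = refl
  ⟪⟫ᶜₕ-assoc (pis x Ξ Δ) Ξ₁ Ξ₂ = cong (λ Ξ' → [] ,, pis x Ξ' Δ) (⟪⟫ᶜ-assoc Ξ Ξ₁ Ξ₂)
  ⟪⟫ᶜₕ-assoc (pet γ x Ξ Δ) Ξ₁ Ξ₂ = cong (λ Ξ' → [] ,, pet γ x Ξ' Δ) (⟪⟫ᶜ-assoc Ξ Ξ₁ Ξ₂)

  Pollinable-⟪⟫ᶜ : ∀ {φ Ξ} Ξ₀ → Pollinable φ Ξ → Pollinable φ (Ξ ⟪ Ξ₀ ⟫ᶜ)
  Pollinable-⟪⟫ᶜ Ξ₀ (Ψ , Ξ' , Ξ₁ , φ∈Ψ , inj₁ Ξ≅) =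
    Ψ , Ξ' , Ξ₁ ⟪ Ξ₀ ⟫ᶜ , φ∈Ψ , inj₁ (subst (_ ≅X_) regroup (≅X-⟪⟫ᶜ Ξ₀ Ξ≅))
    where
    regroup : (Ξ' ⟪ Ψ ⊕ Ξ₁ ⟫ᶜ) ⟪ Ξ₀ ⟫ᶜ ≡ Ξ' ⟪ Ψ ⊕ (Ξ₁ ⟪ Ξ₀ ⟫ᶜ) ⟫ᶜ
    regroup = trans (⟪⟫ᶜ-assoc Ξ' (Ψ ⊕ Ξ₁) Ξ₀) (cong (Ξ' ⟪_⟫ᶜ) (⊕-⟪⟫ᶜ Ψ Ξ₁ Ξ₀))
  Pollinable-⟪⟫ᶜ Ξ₀ (Ψ , Ξ' , Ξ₁ , φ∈Ψ , inj₂ (x , y , Δ , Ξ≅)) =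
    Ψ , Ξ' , Ξ₁ ⟪ Ξ₀ ⟫ᶜ , φ∈Ψ ,
    inj₂ (x , y , Δ , subst (_ ≅X_) (⟪⟫ᶜ-assoc Ξ' ([] ,, pet (x · Ψ) y Ξ₁ Δ) Ξ₀) (≅X-⟪⟫ᶜ Ξ₀ Ξ≅))

  PollinableB-⟪⟫ᶜ : ∀ {Φ Ξ} Ξ₀ → PollinableB Φ Ξ → PollinableB Φ (Ξ ⟪ Ξ₀ ⟫ᶜ)
  PollinableB-⟪⟫ᶜ Ξ₀ = All.map (Pollinable-⟪⟫ᶜ Ξ₀)

  PollinableB-pistil : ∀ Ξ x Ψ y Ξ₀ Δ → PollinableB Ψ (Ξ ⟪ [] ,, pet (x · Ψ) y Ξ₀ Δ ⟫ᶜ)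
  PollinableB-pistil Ξ x Ψ y Ξ₀ Δ =
    All.tabulate (λ φ∈Ψ → Ψ , Ξ , Ξ₀ , φ∈Ψ , inj₂ (x , y , Δ , ≅X-refl _))

  →N*-⟪⟫ᶜ : ∀ Ξ Ξ₀ {Φ Φ'} → ((Ξ ⟪ Ξ₀ ⟫ᶜ) ⟪ Φ ⟫) →N* ((Ξ ⟪ Ξ₀ ⟫ᶜ) ⟪ Φ' ⟫) →
            (Ξ ⟪ Ξ₀ ⟪ Φ ⟫ ⟫) →N* (Ξ ⟪ Ξ₀ ⟪ Φ' ⟫ ⟫)
  →N*-⟪⟫ᶜ Ξ Ξ₀ {Φ} {Φ'} = subst₂ _→N*_ (⟪⟫ᶜ-⟪⟫ Ξ Ξ₀ Φ) (⟪⟫ᶜ-⟪⟫ Ξ Ξ₀ Φ')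

  ⊢N-⇒-intro : ∀ Ψ Φ → Ψ ⊢N Φ → ⊢N [ Ψ ⇒ Φ ]
  ⊢N-⇒-intro Ψ Φ Ψ⊢Φ Ξ _ =
    →N*-⟪⟫ᶜ Ξ petal (Ψ⊢Φ (Ξ ⟪ petal ⟫ᶜ) (PollinableB-pistil Ξ [] Ψ [] ([] ,, □) []))
    ◅◅ return (inj₂ (rule Ξ (epet ([] · Ψ) [])))
    where petal = [] ,, pet ([] · Ψ) [] ([] ,, □) []

  ⊢N-⇒-elim : ∀ Ψ Φ → ⊢N [ Ψ ⇒ Φ ] → Ψ ⊢N Φ
  ⊢N-⇒-elim Ψ Φ ⊢Ψ⇒Φ Ξ Ψ-pollinable =
    return (inj₂ (rule Ξ (epis Φ)))
    ◅◅ →N*-⟪⟫ᶜ Ξ pistil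
         (return (inj₂ (poll↑ (Ξ ⟪ pistil ⟫ᶜ) Ψ (PollinableB-⟪⟫ᶜ pistil Ψ-pollinable))))
    ◅◅ ⊢Ψ⇒Φ Ξ []
    where pistil = [] ,, pis [] ([] ,, □) [ [] · Φ ]

mainTheorem2 : ∀ {P : Set} (ar : P → ℕ) → P ↣ ℕ →
    let open Syntax ar in
    (Ψ Φ : Bouquet) → WF Ψ → WF Φ →
    (Ψ ⊢N Φ) ⇔ (⊢N [ Ψ ⇒ Φ ])
mainTheorem2 ar _ Ψ Φ _ _ = mk⇔ (⊢N-⇒-intro ar Ψ Φ) (⊢N-⇒-elim ar Ψ Φ)
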